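{- For every integer $n\ge 1$, $$ CC_n=\Pi(n)\sum_{k=1}^{n}\binom{n+1}{k+1}\frac{(-1)^k\,\Pi(k)}{\Pi(n+k)}\left[ {n+k}\atop{k}\right]_C . $$
   Context: Let $r$ be a power of a prime, $T$ an indeterminate and $K=\mathbb F_r(T)$. For $i\ge 1$ put $[i]=T^{r^i}-T$, $D_i=[i][i-1]^r\cdots[1]^{r^{i-1}}$ and $L_i=[i][i-1]\cdots[1]$, with $D_0=L_0=1$. The Carlitz logarithm is $\log_C(x)=\sum_{i=0}^\infty(-1)^i x^{r^i}/L_i\in K[[x]]$. For a non-negative integer $i$ with base-$r$ expansion $i=\sum_{j=0}^m c_j r^j$ ($0\le c_j<r$), the Carlitz factorial is $\Pi(i)=\prod_{j=0}^m D_j^{c_j}$. The Cauchy-Carlitz numbers $CC_n$ are defined by $\frac{x}{\log_C(x)}=\sum_{n=0}^\infty\frac{CC_n}{\Pi(n)}x^n$, and the Stirling-Carlitz numbers of the first kind by $\frac{(\log_C(z))^k}{\Pi(k)}=\sum_{n=0}^\infty\left[ {n}\atop{k}\right]_C\frac{z^n}{\Pi(n)}$. Binomial coefficients are ordinary integers viewed in $K$. -}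

module Defs where

open import Level using (Level; _⊔_) renaming (suc to lsuc)
open import Algebra.Bundles using (CommutativeRing)
open import Algebra.Morphism.Structures using (module RingMorphisms)
open import Data.Nat using (ℕ; zero; suc; NonZero) renaming (_+_ to _+ℕ_; _∸_ to _∸ℕ_; _^_ to _^ℕ_)
open import Data.Nat.DivMod using (_/_; _%_)
open import Data.Nat.Combinatorics using (_C_)
open import Data.Nat.Properties using (_≟_)
open import Data.Fin using (Fin)
open import Data.Vec using (Vec; lookup)
open import Data.List using (List; []; _∷_; map)
open import Data.List.Relation.Unary.All using (All)
open import Data.Product using (∃)
open import Data.Bool using (if_then_else_)
open import Relation.Nullary using (¬_)
open import Relation.Nullary.Decidable using (⌊_⌋)
open import Relation.Binary.PropositionalEquality using (_≡_)

record Field (c ℓ : Level) : Set (lsuc (c ⊔ ℓ)) where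
  field
    commutativeRing : CommutativeRing c ℓ
  open CommutativeRing commutativeRing public
  field
    _⁻¹        : Carrier → Carrier
    ⁻¹-inverse : ∀ x → ¬ (x ≈ 0#) → x * (x ⁻¹) ≈ 1#
    1≉0        : ¬ (1# ≈ 0#)

record HasSize {c ℓ} (F : Field c ℓ) (r : ℕ) : Set (c ⊔ ℓ) where
  open Field F
  field
    elems    : Vec Carrier r
    complete : ∀ x → ∃ λ (i : Fin r) → x ≈ lookup elems i
    distinct : ∀ (i j : Fin r) → lookup elems i ≈ lookup elems j → i ≡ j

IsRingHom : ∀ {c₁ ℓ₁ c₂ ℓ₂} (F : Field c₁ ℓ₁) (K : Field c₂ ℓ₂) →
            (Field.Carrier F → Field.Carrier K) → Set (c₁ ⊔ ℓ₁ ⊔ ℓ₂)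
IsRingHom F K ι = RingMorphisms.IsRingHomomorphism (Field.rawRing F) (Field.rawRing K) ι

module _ {c ℓ} (K : Field c ℓ) where
  open Field K
  evalPoly : List Carrier → Carrier → Carrier
  evalPoly []       x = 0#
  evalPoly (a ∷ as) x = a + x * evalPoly as x

Transcendental : ∀ {c₁ ℓ₁ c₂ ℓ₂} (F : Field c₁ ℓ₁) (K : Field c₂ ℓ₂) →
                 (Field.Carrier F → Field.Carrier K) → Field.Carrier K →
                 Set (c₁ ⊔ ℓ₁ ⊔ ℓ₂)
Transcendental F K ι T =
  ∀ (cs : List (Field.Carrier F)) →
    Field._≈_ K (evalPoly K (map ι cs) T) (Field.0# K) →
    All (λ a → Field._≈_ F a (Field.0# F)) cs

module Carlitz {c ℓ} (K : Field c ℓ) (r : ℕ) {{_ : NonZero r}} (T : Field.Carrier K) where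
  open Field K

  pow : Carrier → ℕ → Carrier
  pow x zero    = 1#
  pow x (suc n) = x * pow x n

  fromℕ : ℕ → Carrier
  fromℕ zero    = 0#
  fromℕ (suc n) = 1# + fromℕ n

  sign : ℕ → Carrier
  sign k = pow (- 1#) k

  prod : ℕ → (ℕ → Carrier) → Carrier
  prod zero    f = 1#
  prod (suc n) f = prod n f * f n

  sum : ℕ → (ℕ → Carrier) → Carrier
  sum zero    f = 0#
  sum (suc n) f = sum n f + f n

  br : ℕ → Carrier
  br i = pow T (r ^ℕ i) - T

  D : ℕ → Carrier
  D i = prod i (λ j → pow (br (i ∸ℕ j)) (r ^ℕ j))

  L : ℕ → Carrier
  L i = prod i (λ j → br (i ∸ℕ j))

  digit : ℕ → ℕ → ℕ
  digit zero    i = i % r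
  digit (suc j) i = digit j (i / r)

  -- Carlitz factorial Π(i) = ∏_j D_j^{c_j}; digits c_j with j > i vanish
  Π : ℕ → Carrier
  Π i = prod (suc i) (λ j → pow (D j) (digit j i))

  -- coefficients of log_C(x) = ∑_i (-1)^i x^{r^i} / L_i :
  -- coefficient of x^m is (-1)^i / L_i if m = r^i, and 0 otherwise
  -- (r ≥ 2, so r^i = m forces i ≤ m, and such i is unique).
  logC : ℕ → Carrier
  logC m = sum (suc m) (λ i → if ⌊ m ≟ r ^ℕ i ⌋ then sign i * (L i ⁻¹) else 0#)

  conv : (ℕ → Carrier) → (ℕ → Carrier) → ℕ → Carrier
  conv a b n = sum (suc n) (λ k → a k * b (n ∸ℕ k))

  one : ℕ → Carrier
  one zero    = 1#
  one (suc _) = 0#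

  X : ℕ → Carrier
  X zero          = 0#
  X (suc zero)    = 1#
  X (suc (suc _)) = 0#

  logPow : ℕ → ℕ → Carrier
  logPow zero    = one
  logPow (suc k) = conv logC (logPow k)

  -- Stirling–Carlitz numbers of the first kind:
  -- (log_C z)^k / Π(k) = ∑_n [n k]_C z^n / Π(n)
  Stirling : ℕ → ℕ → Carrier
  Stirling n k = Π n * (Π k ⁻¹ * logPow k n)

  -- a : ℕ → K is the coefficient sequence of x / log_C(x), i.e.
  -- (∑ a_n x^n) · log_C(x) = x.  Then CC_n = Π(n) a_n.

  IsXOverLogC : (ℕ → Carrier) → Set ℓ
  IsXOverLogC a = ∀ n → conv a logC n ≈ X n

  CC : (ℕ → Carrier) → ℕ → Carrier
  CC a n = Π n * a n

  rhs : ℕ → Carrier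
  rhs n = Π n * sum n (λ j →
            let k = suc j in
            fromℕ ((n +ℕ 1) C (k +ℕ 1)) * (sign k * (Π k * ((Π (n +ℕ k) ⁻¹) * Stirling (n +ℕ k) k))))

{-# OPTIONS --safe #-}
module Submission where

-- Since log_C(0) = 0 and the linear coefficient of log_C is 1, the series
-- u = log_C(x)/x has constant term 1 and x/log_C(x) is its inverse a.
-- With g = 1 - u one has u(1 + g + ⋯ + gⁿ) = 1 - gⁿ⁺¹, and gⁿ⁺¹ = O(xⁿ⁺¹)
-- because g(0) = 0; hence aₙ is the n-th coefficient of
-- ∑_{j≤n} (1 - u)ʲ = ∑_{k≤n} C(n+1,k+1) (-1)ᵏ uᵏ.  The n-th coefficient of
-- uᵏ is the (n+k)-th one of log_Cᵏ, that is Π(k)/Π(n+k) [n+k k]_C.  The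
-- divisions are legitimate: Carlitz factorials are products of the
-- [i] = T^{rⁱ} - T, which do not vanish because T is transcendental over
-- F and r ≥ 2 (F is a field with r elements).

open import Defs
open import Level using (Level)
open import Algebra.Morphism.Structures using (module RingMorphisms)
import Algebra.Properties.Ring as RingProperties
import Algebra.Solver.CommutativeMonoid as CommutativeMonoidSolver
open import Data.Bool using (if_then_else_)
open import Data.Empty using (⊥-elim)
open import Data.Fin using () renaming (zero to fzero)
open import Data.List using (List; []; _∷_; map)
open import Data.List.Relation.Unary.All using (_∷_)
open import Data.Nat using (ℕ; zero; suc; NonZero; _≤_; _<_; z≤n; s≤s; _≟_)
  renaming (_+_ to _+ℕ_; _∸_ to _∸ℕ_; _^_ to _^ℕ_)
open import Data.Nat.Combinatorics using (_C_; nCk+nC[k+1]≡[n+1]C[k+1]; k>n⇒nCk≡0)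
import Data.Nat.Properties as ℕ
open import Data.Product using (_,_)
open import Relation.Binary.PropositionalEquality as ≡ using (_≡_)
open import Relation.Nullary using (¬_; yes; no)
open import Relation.Nullary.Decidable using (⌊_⌋)

module FieldProperties {c ℓ} (K : Field c ℓ) where
  open Field K
  open import Relation.Binary.Reasoning.Setoid setoid

  x⁻¹*[x*y]≈y : ∀ {x} y → ¬ (x ≈ 0#) → x ⁻¹ * (x * y) ≈ y
  x⁻¹*[x*y]≈y {x} y x≉0 = begin
    x ⁻¹ * (x * y) ≈⟨ *-assoc _ _ _ ⟨
    (x ⁻¹ * x) * y ≈⟨ *-congʳ (trans (*-comm _ _) (⁻¹-inverse x x≉0)) ⟩
    1# * y         ≈⟨ *-identityˡ y ⟩
    y              ∎

  x*[x⁻¹*y]≈y : ∀ {x} y → ¬ (x ≈ 0#) → x * (x ⁻¹ * y) ≈ y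
  x*[x⁻¹*y]≈y {x} y x≉0 = begin
    x * (x ⁻¹ * y) ≈⟨ *-assoc _ _ _ ⟨
    (x * x ⁻¹) * y ≈⟨ *-congʳ (⁻¹-inverse x x≉0) ⟩
    1# * y         ≈⟨ *-identityˡ y ⟩
    y              ∎

  *-nonzero : ∀ {x y} → ¬ (x ≈ 0#) → ¬ (y ≈ 0#) → ¬ (x * y ≈ 0#)
  *-nonzero {x} {y} x≉0 y≉0 xy≈0 = y≉0 (begin
    y              ≈⟨ x⁻¹*[x*y]≈y y x≉0 ⟨
    x ⁻¹ * (x * y) ≈⟨ *-congˡ xy≈0 ⟩
    x ⁻¹ * 0#      ≈⟨ zeroʳ _ ⟩
    0#             ∎)

module PowerSeries {c ℓ} (K : Field c ℓ) (r : ℕ) {{_ : NonZero r}} (T : Field.Carrier K) where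
  open Field K
  open Carlitz K r T
  open RingProperties ring using (-0#≈0#; -‿+-comm; xyx⁻¹≈y; -‿distribˡ-*; -‿distribʳ-*; -1*x≈-x)
  open CommutativeMonoidSolver +-commutativeMonoid using (solve; _⊜_; _⊕_)
  open import Relation.Binary.Reasoning.Setoid setoid

  Series : Set c
  Series = ℕ → Carrier

  shift : Series → Series
  shift f i = f (suc i)

  sum-cong : ∀ n {f g : ℕ → Carrier} → (∀ i → i < n → f i ≈ g i) → sum n f ≈ sum n g
  sum-cong zero    f≈g = refl
  sum-cong (suc n) f≈g = +-cong (sum-cong n (λ i i<n → f≈g i (ℕ.m<n⇒m<1+n i<n))) (f≈g n ℕ.≤-refl)

  sum-≈0 : ∀ n {f : ℕ → Carrier} → (∀ i → i < n → f i ≈ 0#) → sum n f ≈ 0#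
  sum-≈0 zero    f≈0 = refl
  sum-≈0 (suc n) f≈0 =
    trans (+-cong (sum-≈0 n (λ i i<n → f≈0 i (ℕ.m<n⇒m<1+n i<n))) (f≈0 n ℕ.≤-refl)) (+-identityˡ _)

  sum-+ : ∀ n (f g : ℕ → Carrier) → sum n (λ i → f i + g i) ≈ sum n f + sum n g
  sum-+ zero    f g = sym (+-identityˡ _)
  sum-+ (suc n) f g = begin
    sum n (λ i → f i + g i) + (f n + g n) ≈⟨ +-congʳ (sum-+ n f g) ⟩
    (sum n f + sum n g) + (f n + g n)
      ≈⟨ solve 4 (λ a b c d → (a ⊕ b) ⊕ (c ⊕ d) ⊜ (a ⊕ c) ⊕ (b ⊕ d)) refl
               (sum n f) (sum n g) (f n) (g n) ⟩
    (sum n f + f n) + (sum n g + g n)     ∎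

  sum-*ˡ : ∀ n x (f : ℕ → Carrier) → sum n (λ i → x * f i) ≈ x * sum n f
  sum-*ˡ zero    x f = sym (zeroʳ x)
  sum-*ˡ (suc n) x f = trans (+-congʳ (sum-*ˡ n x f)) (sym (distribˡ _ _ _))

  sum-neg : ∀ n (f : ℕ → Carrier) → sum n (λ i → - f i) ≈ - sum n f
  sum-neg zero    f = sym -0#≈0#
  sum-neg (suc n) f = trans (+-congʳ (sum-neg n f)) (-‿+-comm _ _)

  sum-suc : ∀ n (f : ℕ → Carrier) → sum (suc n) f ≈ f 0 + sum n (shift f)
  sum-suc zero    f = trans (+-identityˡ _) (sym (+-identityʳ _))
  sum-suc (suc n) f = trans (+-congʳ (sum-suc n f)) (+-assoc _ _ _)

  conv-cong : ∀ {a a′ b b′ : Series} → (∀ i → a i ≈ a′ i) → (∀ i → b i ≈ b′ i) →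
              ∀ n → conv a b n ≈ conv a′ b′ n
  conv-cong a≈a′ b≈b′ n = sum-cong (suc n) (λ k _ → *-cong (a≈a′ k) (b≈b′ (n ∸ℕ k)))

  conv-congʳ : ∀ (a : Series) {b b′ : Series} → (∀ i → b i ≈ b′ i) → ∀ n → conv a b n ≈ conv a b′ n
  conv-congʳ a = conv-cong {a = a} (λ _ → refl)

  conv-sucˡ : ∀ (a b : Series) n → conv a b (suc n) ≈ a 0 * b (suc n) + conv (shift a) b n
  conv-sucˡ a b n = sum-suc (suc n) _

  conv-sucʳ : ∀ (a b : Series) n → conv a b (suc n) ≈ conv a (shift b) n + a (suc n) * b 0
  conv-sucʳ a b n = +-cong
    (sum-cong (suc n) (λ k k≤n → *-congˡ (reflexive (≡.cong b (ℕ.+-∸-assoc 1 (ℕ.≤-pred k≤n))))))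
    (*-congˡ (reflexive (≡.cong b (ℕ.n∸n≡0 n))))

  conv-+ˡ : ∀ (a a′ b : Series) n → conv (λ i → a i + a′ i) b n ≈ conv a b n + conv a′ b n
  conv-+ˡ a a′ b n = trans (sum-cong (suc n) (λ k _ → distribʳ _ _ _)) (sum-+ (suc n) _ _)

  conv-+ʳ : ∀ (a b b′ : Series) n → conv a (λ i → b i + b′ i) n ≈ conv a b n + conv a b′ n
  conv-+ʳ a b b′ n = trans (sum-cong (suc n) (λ k _ → distribˡ _ _ _)) (sum-+ (suc n) _ _)

  conv-*ˡ : ∀ x (a b : Series) n → conv (λ i → x * a i) b n ≈ x * conv a b n
  conv-*ˡ x a b n = trans (sum-cong (suc n) (λ k _ → *-assoc _ _ _)) (sum-*ˡ (suc n) _ _)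

  conv-*ʳ : ∀ x (a b : Series) n → conv a (λ i → x * b i) n ≈ x * conv a b n
  conv-*ʳ x a b n = trans (sum-cong (suc n) (λ k _ → x*[y*z]≈y*[x*z] _ _ _)) (sum-*ˡ (suc n) _ _)
    where
    x*[y*z]≈y*[x*z] : ∀ x y z → x * (y * z) ≈ y * (x * z)
    x*[y*z]≈y*[x*z] x y z =
      trans (sym (*-assoc _ _ _)) (trans (*-congʳ (*-comm x y)) (*-assoc _ _ _))

  conv-negˡ : ∀ (a b : Series) n → conv (λ i → - a i) b n ≈ - conv a b n
  conv-negˡ a b n = trans (sum-cong (suc n) (λ k _ → sym (-‿distribˡ-* _ _))) (sum-neg (suc n) _)

  conv-negʳ : ∀ (a b : Series) n → conv a (λ i → - b i) n ≈ - conv a b n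
  conv-negʳ a b n = trans (sum-cong (suc n) (λ k _ → sym (-‿distribʳ-* _ _))) (sum-neg (suc n) _)

  conv-≈0ˡ : ∀ (a b : Series) n → (∀ i → i ≤ n → a i ≈ 0#) → conv a b n ≈ 0#
  conv-≈0ˡ a b n a≈0 = sum-≈0 (suc n) (λ k k≤n → trans (*-congʳ (a≈0 k (ℕ.≤-pred k≤n))) (zeroˡ _))

  conv-≈0ʳ : ∀ (a b : Series) n → (∀ i → i ≤ n → b i ≈ 0#) → conv a b n ≈ 0#
  conv-≈0ʳ a b n b≈0 =
    sum-≈0 (suc n) (λ k _ → trans (*-congˡ (b≈0 (n ∸ℕ k) (ℕ.m∸n≤m n k))) (zeroʳ _))

  conv-identityˡ : ∀ (b : Series) n → conv one b n ≈ b n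
  conv-identityˡ b zero    = trans (+-identityˡ _) (*-identityˡ _)
  conv-identityˡ b (suc n) = begin
    conv one b (suc n)                      ≈⟨ conv-sucˡ one b n ⟩
    1# * b (suc n) + conv (shift one) b n   ≈⟨ +-cong (*-identityˡ _) (conv-≈0ˡ _ b n (λ _ _ → refl)) ⟩
    b (suc n) + 0#                          ≈⟨ +-identityʳ _ ⟩
    b (suc n)                               ∎

  conv-identityʳ : ∀ (a : Series) n → conv a one n ≈ a n
  conv-identityʳ a zero    = trans (+-identityˡ _) (*-identityʳ _)
  conv-identityʳ a (suc n) = begin
    conv a one (suc n)                      ≈⟨ conv-sucʳ a one n ⟩
    conv a (shift one) n + a (suc n) * 1#   ≈⟨ +-cong (conv-≈0ʳ a _ n (λ _ _ → refl)) (*-identityʳ _) ⟩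
    0# + a (suc n)                          ≈⟨ +-identityˡ _ ⟩
    a (suc n)                               ∎

  conv-assoc : ∀ n (a b c : Series) → conv (conv a b) c n ≈ conv a (conv b c) n
  conv-assoc zero    a b c = +-congˡ (begin
    (0# + a 0 * b 0) * c 0 ≈⟨ *-congʳ (+-identityˡ _) ⟩
    (a 0 * b 0) * c 0      ≈⟨ *-assoc _ _ _ ⟩
    a 0 * (b 0 * c 0)      ≈⟨ *-congˡ (+-identityˡ _) ⟨
    a 0 * (0# + b 0 * c 0) ∎)
  conv-assoc (suc n) a b c = begin
    conv (conv a b) c (suc n)
      ≈⟨ conv-sucˡ (conv a b) c n ⟩
    conv a b 0 * c (suc n) + conv (shift (conv a b)) c n
      ≈⟨ +-cong (*-congʳ (+-identityˡ _)) (conv-cong {b = c} (conv-sucˡ a b) (λ _ → refl) n) ⟩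
    (a 0 * b 0) * c (suc n) + conv (λ i → a 0 * b (suc i) + conv (shift a) b i) c n
      ≈⟨ +-congˡ (conv-+ˡ _ _ c n) ⟩
    (a 0 * b 0) * c (suc n) + (conv (λ i → a 0 * b (suc i)) c n + conv (conv (shift a) b) c n)
      ≈⟨ +-congˡ (+-cong (conv-*ˡ (a 0) _ c n) (conv-assoc n (shift a) b c)) ⟩
    (a 0 * b 0) * c (suc n) + (a 0 * conv (shift b) c n + conv (shift a) (conv b c) n)
      ≈⟨ +-assoc _ _ _ ⟨
    ((a 0 * b 0) * c (suc n) + a 0 * conv (shift b) c n) + conv (shift a) (conv b c) n
      ≈⟨ +-congʳ (trans (+-congʳ (*-assoc _ _ _)) (sym (distribˡ _ _ _))) ⟩
    a 0 * (b 0 * c (suc n) + conv (shift b) c n) + conv (shift a) (conv b c) n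
      ≈⟨ +-congʳ (*-congˡ (conv-sucˡ b c n)) ⟨
    a 0 * conv b c (suc n) + conv (shift a) (conv b c) n
      ≈⟨ conv-sucˡ a (conv b c) n ⟨
    conv a (conv b c) (suc n) ∎

  conv-sumʳ : ∀ m (a : Series) (F : ℕ → Series) n →
              conv a (λ j → sum m (λ k → F k j)) n ≈ sum m (λ k → conv a (F k) n)
  conv-sumʳ zero    a F n = conv-≈0ʳ a _ n (λ _ _ → refl)
  conv-sumʳ (suc m) a F n =
    trans (conv-+ʳ a (λ j → sum m (λ k → F k j)) (F m) n) (+-congʳ (conv-sumʳ m a F n))

  conv-shiftˡ : ∀ (a b : Series) n → a 0 ≈ 0# → conv a b (suc n) ≈ conv (shift a) b n
  conv-shiftˡ a b n a₀≈0 = begin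
    conv a b (suc n)                       ≈⟨ conv-sucˡ a b n ⟩
    a 0 * b (suc n) + conv (shift a) b n   ≈⟨ +-congʳ (trans (*-congʳ a₀≈0) (zeroˡ _)) ⟩
    0# + conv (shift a) b n                ≈⟨ +-identityˡ _ ⟩
    conv (shift a) b n                     ∎

  conv-shiftʳ : ∀ k (a b : Series) m → (∀ i → i < k → b i ≈ 0#) →
                conv a b (k +ℕ m) ≈ conv a (λ i → b (k +ℕ i)) m
  conv-shiftʳ zero    a b m b≈0 = refl
  conv-shiftʳ (suc k) a b m b≈0 = begin
    conv a b (suc (k +ℕ m))                                  ≈⟨ conv-sucʳ a b (k +ℕ m) ⟩
    conv a (shift b) (k +ℕ m) + a (suc (k +ℕ m)) * b 0
      ≈⟨ +-cong (conv-shiftʳ k a (shift b) m (λ i i<k → b≈0 (suc i) (s≤s i<k)))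
                (trans (*-congˡ (b≈0 0 (s≤s z≤n))) (zeroʳ _)) ⟩
    conv a (λ i → b (suc (k +ℕ i))) m + 0#                  ≈⟨ +-identityʳ _ ⟩
    conv a (λ i → b (suc (k +ℕ i))) m                       ∎

  convPow : Series → ℕ → Series
  convPow f zero    = one
  convPow f (suc k) = conv f (convPow f k)

  convPow-≈0 : ∀ f → f 0 ≈ 0# → ∀ k i → i < k → convPow f k i ≈ 0#
  convPow-≈0 f f₀≈0 (suc k) zero    _         = trans (+-identityˡ _) (trans (*-congʳ f₀≈0) (zeroˡ _))
  convPow-≈0 f f₀≈0 (suc k) (suc i) (s≤s i<k) = trans (conv-shiftˡ f (convPow f k) i f₀≈0)
    (conv-≈0ʳ (shift f) (convPow f k) i (λ j j≤i → convPow-≈0 f f₀≈0 k j (ℕ.≤-trans (s≤s j≤i) i<k)))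

  convPow-shift : ∀ f → f 0 ≈ 0# → ∀ k m → convPow f k (k +ℕ m) ≈ convPow (shift f) k m
  convPow-shift f f₀≈0 zero    m = refl
  convPow-shift f f₀≈0 (suc k) m = begin
    conv f (convPow f k) (suc (k +ℕ m))                  ≈⟨ conv-shiftˡ f (convPow f k) (k +ℕ m) f₀≈0 ⟩
    conv (shift f) (convPow f k) (k +ℕ m)
      ≈⟨ conv-shiftʳ k (shift f) (convPow f k) m (convPow-≈0 f f₀≈0 k) ⟩
    conv (shift f) (λ i → convPow f k (k +ℕ i)) m        ≈⟨ conv-congʳ (shift f) (convPow-shift f f₀≈0 k) m ⟩
    conv (shift f) (convPow (shift f) k) m               ∎

  signedBinomial : ℕ → ℕ → Carrier
  signedBinomial n k = fromℕ (suc n C suc k) * sign k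

  fromℕ-+ : ∀ x y → fromℕ (x +ℕ y) ≈ fromℕ x + fromℕ y
  fromℕ-+ zero    y = sym (+-identityˡ _)
  fromℕ-+ (suc x) y = trans (+-congˡ (fromℕ-+ x y)) (sym (+-assoc _ _ _))

  signedBinomial-pascal : ∀ n k → signedBinomial (suc n) k ≈ fromℕ (suc n C k) * sign k + signedBinomial n k
  signedBinomial-pascal n k = begin
    fromℕ (suc (suc n) C suc k) * sign k
      ≈⟨ *-congʳ (reflexive (≡.cong fromℕ (nCk+nC[k+1]≡[n+1]C[k+1] (suc n) k))) ⟨
    fromℕ (suc n C k +ℕ suc n C suc k) * sign k
      ≈⟨ *-congʳ (fromℕ-+ (suc n C k) (suc n C suc k)) ⟩
    (fromℕ (suc n C k) + fromℕ (suc n C suc k)) * sign k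
      ≈⟨ distribʳ _ _ _ ⟩
    fromℕ (suc n C k) * sign k + signedBinomial n k ∎

  signedBinomial-sign-suc : ∀ n k → fromℕ (suc n C suc k) * sign (suc k) ≈ - signedBinomial n k
  signedBinomial-sign-suc n k =
    trans (*-congˡ (-1*x≈-x (sign k))) (sym (-‿distribʳ-* _ _))

  -- With P k = uᵏ this is the step S_{n+1} = 1 + S_n - u S_n of the geometric
  -- sums S_n = ∑_{j≤n} (1 - u)ʲ.
  sum-signedBinomial-suc : ∀ n (P : ℕ → Carrier) →
    sum (suc (suc n)) (λ k → signedBinomial (suc n) k * P k) ≈
    P 0 + (sum (suc n) (λ k → signedBinomial n k * P k) - sum (suc n) (λ k → signedBinomial n k * P (suc k)))
  sum-signedBinomial-suc n P = begin
    sum (suc (suc n)) (λ k → signedBinomial (suc n) k * P k)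
      ≈⟨ sum-cong (suc (suc n)) (λ k _ → trans (*-congʳ (signedBinomial-pascal n k)) (distribʳ _ _ _)) ⟩
    sum (suc (suc n)) (λ k → new k + old k)  ≈⟨ sum-+ (suc (suc n)) new old ⟩
    sum (suc (suc n)) new + sum (suc (suc n)) old ≈⟨ +-cong new-sum old-sum ⟩
    (P 0 - Σ₂) + Σ₁ ≈⟨ solve 3 (λ x y z → (x ⊕ z) ⊕ y ⊜ x ⊕ (y ⊕ z)) refl (P 0) Σ₁ (- Σ₂) ⟩
    P 0 + (Σ₁ - Σ₂) ∎
    where
    new old : ℕ → Carrier
    new k = (fromℕ (suc n C k) * sign k) * P k
    old k = signedBinomial n k * P k
    Σ₁ = sum (suc n) old
    Σ₂ = sum (suc n) (λ k → signedBinomial n k * P (suc k))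
    new-sum : sum (suc (suc n)) new ≈ P 0 - Σ₂
    new-sum = begin
      sum (suc (suc n)) new  ≈⟨ sum-suc (suc n) new ⟩
      new 0 + sum (suc n) (shift new)
        ≈⟨ +-cong (trans (*-congʳ (trans (*-identityʳ _) (+-identityʳ _))) (*-identityˡ _))
                  (sum-cong (suc n) (λ k _ → trans (*-congʳ (signedBinomial-sign-suc n k))
                                                   (sym (-‿distribˡ-* _ _)))) ⟩
      P 0 + sum (suc n) (λ k → - (signedBinomial n k * P (suc k))) ≈⟨ +-congˡ (sum-neg (suc n) _) ⟩
      P 0 - Σ₂ ∎
    old-sum : sum (suc (suc n)) old ≈ Σ₁
    old-sum = begin
      Σ₁ + old (suc n)
        ≈⟨ +-congˡ (*-congʳ (*-congʳ (reflexive (≡.cong fromℕ (k>n⇒nCk≡0 (ℕ.n<1+n (suc n))))))) ⟩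
      Σ₁ + (0# * sign (suc n)) * P (suc n) ≈⟨ +-congˡ (trans (*-congʳ (zeroˡ _)) (zeroˡ _)) ⟩
      Σ₁ + 0# ≈⟨ +-identityʳ _ ⟩
      Σ₁ ∎

  module Geometric (u : Series) where

    g : Series
    g i = one i - u i

    conv-g : ∀ (b : Series) n → conv g b n ≈ b n - conv u b n
    conv-g b n = trans (conv-+ˡ one (λ i → - u i) b n) (+-cong (conv-identityˡ b n) (conv-negˡ u b n))

    geometric : ℕ → Series
    geometric zero      = one
    geometric (suc n) i = one i + conv g (geometric n) i

    u*geometric : ∀ n i → conv u (geometric n) i + convPow g (suc n) i ≈ one i
    u*geometric zero    i =
      trans (+-cong (conv-identityʳ u i) (conv-identityʳ g i))
            (trans (sym (+-assoc _ _ _)) (xyx⁻¹≈y (u i) (one i)))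
    u*geometric (suc n) i = begin
      conv u (geometric (suc n)) i + conv g (convPow g (suc n)) i
        ≈⟨ +-cong (conv-+ʳ u one (conv g S) i) (conv-g (convPow g (suc n)) i) ⟩
      (conv u one i + conv u (conv g S) i) + (G - conv u (convPow g (suc n)) i)
        ≈⟨ +-congʳ (+-cong (conv-identityʳ u i) u*[g*S]) ⟩
      (u i + (A - B)) + (G - Q)
        ≈⟨ solve 5 (λ x y z w t → (x ⊕ (y ⊕ z)) ⊕ (w ⊕ t) ⊜ (y ⊕ w) ⊕ (x ⊕ (z ⊕ t))) refl
                 (u i) A (- B) G (- Q) ⟩
      (A + G) + (u i + (- B - Q)) ≈⟨ +-cong (u*geometric n i) (+-congˡ (-‿+-comm B Q)) ⟩
      one i + (u i - (B + Q))     ≈⟨ +-congˡ (+-congˡ (-‿cong B+Q≈u)) ⟩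
      one i + (u i - u i)         ≈⟨ +-congˡ (-‿inverseʳ _) ⟩
      one i + 0#                  ≈⟨ +-identityʳ _ ⟩
      one i                       ∎
      where
      S = geometric n
      A = conv u S i
      B = conv u (conv u S) i
      G = convPow g (suc n) i
      Q = conv u (convPow g (suc n)) i
      u*[g*S] : conv u (conv g S) i ≈ A - B
      u*[g*S] = trans (conv-congʳ u (conv-g S) i)
                      (trans (conv-+ʳ u S (λ j → - conv u S j) i) (+-congˡ (conv-negʳ u (conv u S) i)))
      B+Q≈u : B + Q ≈ u i
      B+Q≈u = begin
        B + Q                                          ≈⟨ conv-+ʳ u (conv u S) (convPow g (suc n)) i ⟨
        conv u (λ j → conv u S j + convPow g (suc n) j) i ≈⟨ conv-congʳ u (u*geometric n) i ⟩
        conv u one i                                   ≈⟨ conv-identityʳ u i ⟩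
        u i                                            ∎

    geometric≈signedBinomial : ∀ n i → geometric n i ≈ sum (suc n) (λ k → signedBinomial n k * convPow u k i)
    geometric≈signedBinomial zero    i =
      sym (trans (+-identityˡ _) (trans (*-congʳ (trans (*-identityʳ _) (+-identityʳ _))) (*-identityˡ _)))
    geometric≈signedBinomial (suc n) i = begin
      one i + conv g (geometric n) i                 ≈⟨ +-congˡ (conv-g (geometric n) i) ⟩
      one i + (geometric n i - conv u (geometric n) i)
        ≈⟨ +-congˡ (+-cong (geometric≈signedBinomial n i) (-‿cong u*S)) ⟩
      one i + (sum (suc n) (λ k → signedBinomial n k * convPow u k i)
               - sum (suc n) (λ k → signedBinomial n k * convPow u (suc k) i))
        ≈⟨ sum-signedBinomial-suc n (λ k → convPow u k i) ⟨
      sum (suc (suc n)) (λ k → signedBinomial (suc n) k * convPow u k i) ∎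
      where
      u*S : conv u (geometric n) i ≈ sum (suc n) (λ k → signedBinomial n k * convPow u (suc k) i)
      u*S = begin
        conv u (geometric n) i
          ≈⟨ conv-congʳ u (geometric≈signedBinomial n) i ⟩
        conv u (λ j → sum (suc n) (λ k → signedBinomial n k * convPow u k j)) i
          ≈⟨ conv-sumʳ (suc n) u (λ k j → signedBinomial n k * convPow u k j) i ⟩
        sum (suc n) (λ k → conv u (λ j → signedBinomial n k * convPow u k j) i)
          ≈⟨ sum-cong (suc n) (λ k _ → conv-*ʳ (signedBinomial n k) u (convPow u k) i) ⟩
        sum (suc n) (λ k → signedBinomial n k * convPow u (suc k) i) ∎

  inverse-coeff : ∀ (u a : Series) → u 0 ≈ 1# → (∀ n → conv a u n ≈ one n) →
                  ∀ n → a n ≈ sum (suc n) (λ k → signedBinomial n k * convPow u k n)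
  inverse-coeff u a u₀≈1 a*u≈1 n = begin
    a n                ≈⟨ conv-identityʳ a n ⟨
    conv a one n       ≈⟨ conv-congʳ a (λ i → sym (u*geometric n i)) n ⟩
    conv a (λ i → conv u S i + convPow g (suc n) i) n
      ≈⟨ conv-+ʳ a (conv u S) (convPow g (suc n)) n ⟩
    conv a (conv u S) n + conv a (convPow g (suc n)) n
      ≈⟨ +-cong (sym (conv-assoc n a u S))
                (conv-≈0ʳ a _ n (λ i i≤n → convPow-≈0 g g₀≈0 (suc n) i (s≤s i≤n))) ⟩
    conv (conv a u) S n + 0# ≈⟨ +-identityʳ _ ⟩
    conv (conv a u) S n      ≈⟨ conv-cong {b = S} a*u≈1 (λ _ → refl) n ⟩
    conv one S n             ≈⟨ conv-identityˡ S n ⟩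
    S n                      ≈⟨ geometric≈signedBinomial n n ⟩
    sum (suc n) (λ k → signedBinomial n k * convPow u k n) ∎
    where
    open Geometric u
    S = geometric n
    g₀≈0 : g 0 ≈ 0#
    g₀≈0 = trans (+-congˡ (-‿cong u₀≈1)) (-‿inverseʳ _)

module CarlitzSeries {c ℓ} (K : Field c ℓ) (r : ℕ) {{_ : NonZero r}} (T : Field.Carrier K) where
  open Field K
  open Carlitz K r T
  open PowerSeries K r T
  open FieldProperties K
  open import Relation.Binary.Reasoning.Setoid setoid

  logC-zero : logC 0 ≈ 0#
  logC-zero = +-identityˡ 0#

  logC-one : 2 ≤ r → logC 1 ≈ 1#
  logC-one 2≤r = begin
    (0# + 1# * (1# ⁻¹)) + (if ⌊ 1 ≟ r ^ℕ 1 ⌋ then sign 1 * (L 1 ⁻¹) else 0#)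
      ≈⟨ +-cong (trans (+-identityˡ _) (⁻¹-inverse 1# 1≉0)) (reflexive (if-1≉r _)) ⟩
    1# + 0# ≈⟨ +-identityʳ _ ⟩
    1#      ∎
    where
    if-1≉r : ∀ x → (if ⌊ 1 ≟ r ^ℕ 1 ⌋ then x else 0#) ≡ 0#
    if-1≉r x with 1 ≟ r ^ℕ 1
    ... | yes 1≡r = ⊥-elim (ℕ.<-irrefl (≡.trans 1≡r (ℕ.*-identityʳ r)) 2≤r)
    ... | no  _   = ≡.refl

  logPow≈convPow : ∀ k n → logPow k n ≈ convPow logC k n
  logPow≈convPow zero    n = refl
  logPow≈convPow (suc k) n = conv-congʳ logC (logPow≈convPow k) n

  inverse-of-shift-logC : ∀ {a} → IsXOverLogC a → ∀ n → conv a (shift logC) n ≈ one n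
  inverse-of-shift-logC {a} a*logC≈X n = begin
    conv a (shift logC) n                    ≈⟨ +-identityʳ _ ⟨
    conv a (shift logC) n + 0#               ≈⟨ +-congˡ (trans (*-congˡ logC-zero) (zeroʳ _)) ⟨
    conv a (shift logC) n + a (suc n) * logC 0 ≈⟨ conv-sucʳ a logC n ⟨
    conv a logC (suc n)                      ≈⟨ a*logC≈X (suc n) ⟩
    X (suc n)                                ≈⟨ reflexive (X-suc n) ⟩
    one n                                    ∎
    where
    X-suc : ∀ n → X (suc n) ≡ one n
    X-suc zero    = ≡.refl
    X-suc (suc n) = ≡.refl

  Stirling≈convPow : (∀ m → ¬ (Π m ≈ 0#)) → ∀ k n →
                     Π k * (Π (n +ℕ k) ⁻¹ * Stirling (n +ℕ k) k) ≈ convPow (shift logC) k n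
  Stirling≈convPow Π≉0 k n = begin
    Π k * (Π (n +ℕ k) ⁻¹ * (Π (n +ℕ k) * (Π k ⁻¹ * logPow k (n +ℕ k))))
      ≈⟨ *-congˡ (x⁻¹*[x*y]≈y _ (Π≉0 (n +ℕ k))) ⟩
    Π k * (Π k ⁻¹ * logPow k (n +ℕ k)) ≈⟨ x*[x⁻¹*y]≈y _ (Π≉0 k) ⟩
    logPow k (n +ℕ k)                   ≈⟨ reflexive (≡.cong (logPow k) (ℕ.+-comm n k)) ⟩
    logPow k (k +ℕ n)                   ≈⟨ logPow≈convPow k (k +ℕ n) ⟩
    convPow logC k (k +ℕ n)             ≈⟨ convPow-shift logC logC-zero k n ⟩
    convPow (shift logC) k n            ∎

  rhs-summand : (∀ m → ¬ (Π m ≈ 0#)) → ∀ n k →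
    signedBinomial n k * convPow (shift logC) k n ≈
    fromℕ ((n +ℕ 1) C (k +ℕ 1)) * (sign k * (Π k * ((Π (n +ℕ k) ⁻¹) * Stirling (n +ℕ k) k)))
  rhs-summand Π≉0 n k = begin
    (fromℕ (suc n C suc k) * sign k) * convPow (shift logC) k n ≈⟨ *-assoc _ _ _ ⟩
    fromℕ (suc n C suc k) * (sign k * convPow (shift logC) k n)
      ≈⟨ *-cong (reflexive (≡.cong₂ (λ x y → fromℕ (x C y)) (ℕ.+-comm 1 n) (ℕ.+-comm 1 k)))
                (*-congˡ (sym (Stirling≈convPow Π≉0 k n))) ⟩
    fromℕ ((n +ℕ 1) C (k +ℕ 1)) * (sign k * (Π k * ((Π (n +ℕ k) ⁻¹) * Stirling (n +ℕ k) k))) ∎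

  pow-nonzero : ∀ {x} m → ¬ (x ≈ 0#) → ¬ (pow x m ≈ 0#)
  pow-nonzero zero    x≉0 = 1≉0
  pow-nonzero (suc m) x≉0 = *-nonzero x≉0 (pow-nonzero m x≉0)

  prod-nonzero : ∀ n {f : ℕ → Carrier} → (∀ j → j < n → ¬ (f j ≈ 0#)) → ¬ (prod n f ≈ 0#)
  prod-nonzero zero    f≉0 = 1≉0
  prod-nonzero (suc n) f≉0 = *-nonzero (prod-nonzero n (λ j j<n → f≉0 j (ℕ.m<n⇒m<1+n j<n))) (f≉0 n ℕ.≤-refl)

  Π-nonzero : (∀ i → 1 ≤ i → ¬ (br i ≈ 0#)) → ∀ m → ¬ (Π m ≈ 0#)
  Π-nonzero br≉0 m = prod-nonzero (suc m) (λ j _ → pow-nonzero (digit j m) (D-nonzero j))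
    where
    D-nonzero : ∀ j → ¬ (D j ≈ 0#)
    D-nonzero j = prod-nonzero j (λ i i<j → pow-nonzero (r ^ℕ i) (br≉0 (j ∸ℕ i) (ℕ.m<n⇒0<n∸m i<j)))

  CC≈rhs : 2 ≤ r → (∀ i → 1 ≤ i → ¬ (br i ≈ 0#)) →
           ∀ {a} → IsXOverLogC a → ∀ n → 1 ≤ n → CC a n ≈ rhs n
  CC≈rhs 2≤r br≉0 {a} a*logC≈X n@(suc _) _ = *-congˡ (begin
    a n ≈⟨ inverse-coeff (shift logC) a (logC-one 2≤r) (inverse-of-shift-logC a*logC≈X) n ⟩
    sum (suc n) (λ k → signedBinomial n k * convPow (shift logC) k n) ≈⟨ sum-suc n _ ⟩
    signedBinomial n 0 * 0# + sum n (λ j → signedBinomial n (suc j) * convPow (shift logC) (suc j) n)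
      ≈⟨ trans (+-congʳ (zeroʳ _)) (+-identityˡ _) ⟩
    sum n (λ j → signedBinomial n (suc j) * convPow (shift logC) (suc j) n)
      ≈⟨ sum-cong n (λ j _ → rhs-summand (Π-nonzero br≉0) n (suc j)) ⟩
    sum n (λ j → fromℕ ((n +ℕ 1) C (suc j +ℕ 1)) *
      (sign (suc j) * (Π (suc j) * ((Π (n +ℕ suc j) ⁻¹) * Stirling (n +ℕ suc j) (suc j))))) ∎)

HasSize⇒2≤r : ∀ {c ℓ} (F : Field c ℓ) (r : ℕ) {{_ : NonZero r}} → HasSize F r → 2 ≤ r
HasSize⇒2≤r F (suc (suc r)) size = s≤s (s≤s z≤n)
HasSize⇒2≤r F (suc zero)    size with HasSize.complete size (Field.0# F) | HasSize.complete size (Field.1# F)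
... | fzero , 0≈e | fzero , 1≈e = ⊥-elim (Field.1≉0 F (Field.trans F 1≈e (Field.sym F 0≈e)))

module Transcendence {c₁ ℓ₁ c₂ ℓ₂} (F : Field c₁ ℓ₁) (K : Field c₂ ℓ₂)
                     (ι : Field.Carrier F → Field.Carrier K) (hom : IsRingHom F K ι)
                     (r : ℕ) {{_ : NonZero r}} (T : Field.Carrier K) (T-trans : Transcendental F K ι T) where
  module F = Field F
  open Field K
  open Carlitz K r T
  open RingMorphisms.IsRingHomomorphism hom using (0#-homo; 1#-homo; -‿homo)
  open RingProperties ring using (-1*x≈-x)
  open import Relation.Binary.Reasoning.Setoid setoid

  monomial : ℕ → List F.Carrier
  monomial zero    = F.1# ∷ []
  monomial (suc M) = F.0# ∷ monomial M

  evalPoly-monomial : ∀ M → evalPoly K (map ι (monomial M)) T ≈ pow T M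
  evalPoly-monomial zero    = trans (+-cong 1#-homo (zeroʳ T)) (+-identityʳ _)
  evalPoly-monomial (suc M) = trans (+-cong 0#-homo (*-congˡ (evalPoly-monomial M))) (+-identityˡ _)

  T^[2+M]-T≉0 : ∀ M → ¬ (pow T (suc (suc M)) - T ≈ 0#)
  T^[2+M]-T≉0 M T^[2+M]-T≈0 with T-trans (F.0# ∷ (F.- F.1#) ∷ monomial M) value≈0
    where
    value≈0 : evalPoly K (map ι (F.0# ∷ (F.- F.1#) ∷ monomial M)) T ≈ 0#
    value≈0 = begin
      ι F.0# + T * (ι (F.- F.1#) + T * evalPoly K (map ι (monomial M)) T)
        ≈⟨ +-cong 0#-homo (*-congˡ (+-cong (trans (-‿homo F.1#) (-‿cong 1#-homo))
                                            (*-congˡ (evalPoly-monomial M)))) ⟩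
      0# + T * (- 1# + T * pow T M) ≈⟨ +-identityˡ _ ⟩
      T * (- 1# + T * pow T M)      ≈⟨ distribˡ _ _ _ ⟩
      T * - 1# + pow T (suc (suc M)) ≈⟨ +-comm _ _ ⟩
      pow T (suc (suc M)) + T * - 1# ≈⟨ +-congˡ (trans (*-comm _ _) (-1*x≈-x T)) ⟩
      pow T (suc (suc M)) - T        ≈⟨ T^[2+M]-T≈0 ⟩
      0#                             ∎
  ... | _ ∷ -1≈0 ∷ _ =
    F.1≉0 (F.trans (F.sym (F.+-identityʳ F.1#)) (F.trans (F.+-congˡ (F.sym -1≈0)) (F.-‿inverseʳ F.1#)))

  br-nonzero : 2 ≤ r → ∀ i → 1 ≤ i → ¬ (br i ≈ 0#)
  br-nonzero 2≤r (suc i) _ br≈0 =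
    T^[2+M]-T≉0 M (trans (+-congʳ (reflexive (≡.cong (pow T) (ℕ.m+[n∸m]≡n 2≤rⁱ⁺¹)))) br≈0)
    where
    2≤rⁱ⁺¹ : 2 ≤ r ^ℕ suc i
    2≤rⁱ⁺¹ = ℕ.≤-trans 2≤r (ℕ.m≤m*n r (r ^ℕ i) {{ℕ.m^n≢0 r i}})
    M = r ^ℕ suc i ∸ℕ 2

corollary2 : ∀ {c₁ ℓ₁ c₂ ℓ₂ : Level}
    (F : Field c₁ ℓ₁) (r : ℕ) {{_ : NonZero r}} → HasSize F r →
    (K : Field c₂ ℓ₂) (ι : Field.Carrier F → Field.Carrier K) → IsRingHom F K ι →
    (T : Field.Carrier K) → Transcendental F K ι T →
    (a : ℕ → Field.Carrier K) → Carlitz.IsXOverLogC K r T a →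
    ∀ (n : ℕ) → 1 ≤ n →
    Field._≈_ K (Carlitz.CC K r T a n) (Carlitz.rhs K r T n)
corollary2 F r size K ι hom T T-trans a a*logC≈X =
  CarlitzSeries.CC≈rhs K r T 2≤r (Transcendence.br-nonzero F K ι hom r T T-trans 2≤r) a*logC≈X
  where
  2≤r = HasSize⇒2≤r F r size
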